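{- Let $k$ be a positive integer. Then: (1) For any prime $p$, the integers whose prime decomposition has the form $p_1^{2p^k-1}$ ($p_1$ a prime) are $p^k$-$T_0T^\ast$-perfect numbers. (2) If $k\ge 2$, then for any odd prime $p$, the integers whose prime decomposition has the form $p_1^{(p^{a_1}-1)/2}\cdot p_2^{(p^{a_2}-1)/2}$ ($p_1\ne p_2$ primes), where $a_1,a_2$ are positive integers with $a_1+a_2=k$, are $p^k$-$T_0T^\ast$-perfect numbers. (3) For a prime $p$, any integer $n>1$ whose prime decomposition is neither of the form $p_1^{2p^k-1}$, nor (when $p$ is odd) of the form $p_1^{(p^{a_1}-1)/2}\cdot p_2^{(p^{a_2}-1)/2}$ with positive integers $a_1,a_2$ satisfying $a_1+a_2=k$, is not a $p^k$-$T_0T^\ast$-perfect number.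
   Context: $T(m)$ denotes the product of all positive divisors of $m$. A divisor $d$ of $m$ is unitary if $\gcd(d,m/d)=1$, and $T^\ast(m)$ denotes the product of all unitary divisors of $m$. For an integer $K\ge 2$, an integer $n>1$ is called $K$-$T_0T^\ast$-perfect if $T(T^\ast(n))=n^K$. -}

module Defs where

open import Data.Nat using (ℕ; suc; _*_; _^_; _≤_; _<_)
open import Data.Nat.Divisibility using (_∣_; _∣?_)
open import Data.Nat.GCD using (gcd)
open import Data.Nat.DivMod using (_/_)
open import Data.Nat.Properties using (_≟_)
open import Data.Nat.ListAction using (product)
open import Data.List using (List; filter; map; upTo)
open import Data.Product using (_×_)
open import Relation.Binary.PropositionalEquality using (_≡_)
open import Relation.Nullary.Decidable using (_×-dec_)

divisors : ℕ → List ℕ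
divisors m = map suc (filter (λ e → suc e ∣? m) (upTo m))

unitaryDivisors : ℕ → List ℕ
unitaryDivisors m =
  map suc (filter (λ e → (suc e ∣? m) ×-dec (gcd (suc e) (m / suc e) ≟ 1)) (upTo m))

T : ℕ → ℕ
T m = product (divisors m)

T* : ℕ → ℕ
T* m = product (unitaryDivisors m)

KPerfect : ℕ → ℕ → Set
KPerfect K n = (2 ≤ K) × (1 < n) × (T (T* n) ≡ n ^ K)

module Submission where

-- Write τ(m) and τ*(m) for the numbers of divisors and unitary divisors of m. Pairing each divisor x
-- with m/x gives T(m)² = m^τ(m) and T*(m)² = m^τ*(m). For n > 1, τ*(n) = 2^ω(n) = 2h, so T*(n) = n^h
-- and T(T*(n))² = n^(h τ(n^h)): n is K-perfect exactly when 2K = h τ(n^h). With one prime factor this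
-- reads 2K = e + 1 for n = q^e; with two it reads K = (2e₁+1)(2e₂+1), and for K = p^k both factors
-- must be powers of the odd prime p. With three or more prime factors 4 ∣ h, so p^k = (h/2) τ(n^h)
-- with h/2 even and τ(n^h) odd; this forces τ(n^h) = 1, which is impossible.

open import Defs
open import Data.Empty using (⊥-elim)
open import Data.List using (List; []; _∷_; map; upTo; length; cartesianProduct)
open import Data.List.Membership.Propositional using (_∈_)
open import Data.List.Membership.Propositional.Properties
  using (∈-map⁺; ∈-map⁻; ∈-filter⁺; ∈-filter⁻; ∈-upTo⁺; ∈-upTo⁻; ∈-cartesianProduct⁺; ∈-cartesianProduct⁻)
open import Data.List.Membership.Propositional.Properties.WithK using (unique∧set⇒bag)
open import Data.List.Properties using (length-map; length-++; length-upTo)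
open import Data.List.Relation.Binary.BagAndSetEquality using (∼bag⇒↭)
open import Data.List.Relation.Binary.Permutation.Propositional using (_↭_)
open import Data.List.Relation.Binary.Permutation.Propositional.Properties using (↭-length)
open import Data.List.Relation.Unary.All as All using (_∷_)
open import Data.List.Relation.Unary.All.Properties as All using ()
open import Data.List.Relation.Unary.AllPairs using ([]; _∷_)
open import Data.List.Relation.Unary.Any using (here; there)
open import Data.List.Relation.Unary.Unique.Propositional using (Unique)
open import Data.List.Relation.Unary.Unique.Propositional.Properties as Unique using ()
open import Data.Nat
open import Data.Nat.Coprimality as Coprime using (Coprime; coprime-divisor; coprime⇒gcd≡1; gcd≡1⇒coprime)
open import Data.Nat.Divisibility
open import Data.Nat.DivMod
  using (_/_; _%_; %-distribˡ-*; %-remove-+ʳ; m≡m%n+[m/n]*n; m%n<n; m*[n/m]≡n; m*n/n≡m)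
open import Data.Nat.GCD using (gcd; gcd[m,n]∣m; gcd[m,n]∣n; gcd-greatest; c*gcd[m,n]≡gcd[cm,cn])
open import Data.Nat.Induction using (<-rec)
open import Data.Nat.ListAction using (product)
open import Data.Nat.ListAction.Properties using (product-↭)
open import Data.Nat.Primality using (Prime; euclidsLemma; prime⇒irreducible; prime⇒nonTrivial)
open import Data.Nat.Primality.Factorisation using (factorise)
open import Data.Nat.Properties
open import Algebra.Properties.CommutativeSemigroup *-commutativeSemigroup using (interchange)
open import Data.Product using (∃; ∃-syntax; ∃₂; _×_; _,_; proj₁; proj₂; uncurry)
open import Data.Sum using (_⊎_; inj₁; inj₂; [_,_]′)
open import Function using (_∘_; case_of_; _⇔_; mk⇔; Equivalence)
open import Function.Properties.Equivalence using () renaming (trans to ⇔-trans)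
open import Relation.Binary.Definitions using (tri<; tri≈; tri>)
open import Relation.Binary.PropositionalEquality
open import Relation.Nullary using (¬_; yes; no)
open import Relation.Nullary.Decidable using (_×-dec_)

private variable
  a b d e h i j k m n p q q′ x y D K W : ℕ

*-≢0 : m ≢ 0 → n ≢ 0 → m * n ≢ 0
*-≢0 {m} m≢0 n≢0 mn≡0 with m*n≡0⇒m≡0∨n≡0 m mn≡0
... | inj₁ m≡0 = m≢0 m≡0
... | inj₂ n≡0 = n≢0 n≡0

∣-≢0 : x ∣ m → m ≢ 0 → x ≢ 0
∣-≢0 (divides q m≡q*0) m≢0 refl = m≢0 (trans m≡q*0 (*-zeroʳ q))

n≢0∧n≢1⇒1<n : n ≢ 0 → n ≢ 1 → 1 < n
n≢0∧n≢1⇒1<n n≢0 n≢1 = ≤∧≢⇒< (n≢0⇒n>0 n≢0) (n≢1 ∘ sym)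

m*m≡n*n⇒m≡n : x * x ≡ y * y → x ≡ y
m*m≡n*n⇒m≡n {x} {y} eq with <-cmp x y
... | tri< x<y _ _ = ⊥-elim (<⇒≢ (*-mono-< x<y x<y) eq)
... | tri≈ _ x≡y _ = x≡y
... | tri> _ _ y<x = ⊥-elim (<⇒≢ (*-mono-< y<x y<x) (sym eq))

^-double : ∀ n k → n ^ (2 * k) ≡ n ^ k * n ^ k
^-double n k = trans (cong (λ e → n ^ (k + e)) (+-identityʳ k)) (^-distribˡ-+-* n k k)

^-distribʳ-* : ∀ m n i → (m * n) ^ i ≡ m ^ i * n ^ i
^-distribʳ-* m n zero    = refl
^-distribʳ-* m n (suc i) = trans (cong (m * n *_) (^-distribʳ-* m n i)) (interchange m n (m ^ i) (n ^ i))

^-injective : 1 < p → p ^ i ≡ p ^ j → i ≡ j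
^-injective {p} {i} {j} 1<p eq with <-cmp i j
... | tri< i<j _ _ = ⊥-elim (<⇒≢ (^-monoʳ-< p 1<p i<j) eq)
... | tri≈ _ i≡j _ = i≡j
... | tri> _ _ j<i = ⊥-elim (<⇒≢ (^-monoʳ-< p 1<p j<i) (sym eq))

unique-sameElements⇒↭ : {xs ys : List ℕ} → Unique xs → Unique ys →
  (∀ {z} → z ∈ xs → z ∈ ys) → (∀ {z} → z ∈ ys → z ∈ xs) → xs ↭ ys
unique-sameElements⇒↭ xs! ys! ⊆ ⊇ = ∼bag⇒↭ (unique∧set⇒bag xs! ys! (mk⇔ ⊆ ⊇))

Unique-map⁺-injectiveOn : ∀ {A B : Set} {xs : List A} (f : A → B) →
  (∀ {x y} → x ∈ xs → y ∈ xs → f x ≡ f y → x ≡ y) → Unique xs → Unique (map f xs)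
Unique-map⁺-injectiveOn {xs = []}    f inj []          = []
Unique-map⁺-injectiveOn {xs = x ∷ _} f inj (x∉ ∷ xs!) =
  All.map⁺ (All.tabulate λ y∈ fx≡fy → All.lookup x∉ y∈ (inj (here refl) (there y∈) fx≡fy))
  ∷ Unique-map⁺-injectiveOn f (λ x∈ y∈ → inj (there x∈) (there y∈)) xs!

product*product-map : ∀ (g : ℕ → ℕ) xs →
  product xs * product (map g xs) ≡ product (map (λ x → x * g x) xs)
product*product-map g []       = refl
product*product-map g (x ∷ xs) = trans (interchange x (product xs) (g x) (product (map g xs)))
  (cong (x * g x *_) (product*product-map g xs))

product-map-const : ∀ (f : ℕ → ℕ) xs → (∀ {x} → x ∈ xs → f x ≡ m) → product (map f xs) ≡ m ^ length xs
product-map-const f []       f≡m = refl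
product-map-const f (x ∷ xs) f≡m = cong₂ _*_ (f≡m (here refl)) (product-map-const f xs (f≡m ∘ there))

product²-involution : ∀ (g : ℕ → ℕ) xs → Unique xs →
  (∀ {x} → x ∈ xs → g x ∈ xs) → (∀ {x} → x ∈ xs → g (g x) ≡ x) → (∀ {x} → x ∈ xs → x * g x ≡ m) →
  product xs * product xs ≡ m ^ length xs
product²-involution {m} g xs xs! closed involutive pairs = begin
  product xs * product xs        ≡⟨ cong (product xs *_) (product-↭ xs↭gxs) ⟩
  product xs * product (map g xs) ≡⟨ product*product-map g xs ⟩
  product (map (λ x → x * g x) xs) ≡⟨ product-map-const _ xs pairs ⟩
  m ^ length xs                    ∎
  where
  open ≡-Reasoning
  xs↭gxs : xs ↭ map g xs
  xs↭gxs = unique-sameElements⇒↭ xs!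
    (Unique-map⁺-injectiveOn g (λ x∈ y∈ gx≡gy → trans (sym (involutive x∈)) (trans (cong g gx≡gy) (involutive y∈)))
      xs!)
    (λ x∈ → subst (_∈ map g xs) (involutive x∈) (∈-map⁺ g (closed x∈)))
    (λ y∈ → case ∈-map⁻ g y∈ of λ where (x , x∈ , refl) → closed x∈)

products : List ℕ → List ℕ → List ℕ
products xs ys = map (uncurry _*_) (cartesianProduct xs ys)

length-products : ∀ xs ys → length (products xs ys) ≡ length xs * length ys
length-products xs ys = trans (length-map _ (cartesianProduct xs ys)) (length-cartesianProduct xs)
  where
  length-cartesianProduct : ∀ xs → length (cartesianProduct xs ys) ≡ length xs * length ys
  length-cartesianProduct []       = refl
  length-cartesianProduct (x ∷ xs) = trans (length-++ (map (x ,_) ys))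
    (cong₂ _+_ (length-map (x ,_) ys) (length-cartesianProduct xs))

∈-products⁺ : ∀ {xs ys} → x ∈ xs → y ∈ ys → x * y ∈ products xs ys
∈-products⁺ x∈ y∈ = ∈-map⁺ (uncurry _*_) (∈-cartesianProduct⁺ x∈ y∈)

Coprime-∣ : Coprime m n → x ∣ m → y ∣ n → Coprime x y
Coprime-∣ coprime x∣m y∣n (d∣x , d∣y) = coprime (∣-trans d∣x x∣m , ∣-trans d∣y y∣n)

Coprime-*ˡ : Coprime x n → Coprime y n → Coprime (x * y) n
Coprime-*ˡ x⊥n y⊥n (d∣xy , d∣n) =
  y⊥n (coprime-divisor (Coprime-∣ (Coprime.sym x⊥n) d∣n ∣-refl) d∣xy , d∣n)

Coprime-*ʳ : Coprime n x → Coprime n y → Coprime n (x * y)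
Coprime-*ʳ n⊥x n⊥y = Coprime.sym (Coprime-*ˡ (Coprime.sym n⊥x) (Coprime.sym n⊥y))

Coprime-^ˡ : Coprime x n → ∀ i → Coprime (x ^ i) n
Coprime-^ˡ x⊥n zero    (d∣1 , _) = ∣1⇒≡1 d∣1
Coprime-^ˡ x⊥n (suc i) = Coprime-*ˡ x⊥n (Coprime-^ˡ x⊥n i)

Coprime⇒*∣ : Coprime x y → x ∣ m → y ∣ m → x * y ∣ m
Coprime⇒*∣ {x} {y} x⊥y (divides q refl) y∣qx =
  subst (_∣ q * x) (*-comm y x)
    (*-monoˡ-∣ x (coprime-divisor (Coprime.sym x⊥y) (subst (y ∣_) (*-comm q x) y∣qx)))

∣*⇒≡gcd*gcd : Coprime a b → x ∣ a * b → x ≡ gcd x a * gcd x b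
∣*⇒≡gcd*gcd {a} {b} {x} a⊥b x∣ab = ∣-antisym x∣gcds gcds∣x
  where
  x∣b*gcd : x ∣ b * gcd x a
  x∣b*gcd = subst (x ∣_) (sym (c*gcd[m,n]≡gcd[cm,cn] b x a))
    (gcd-greatest (n∣m*n b) (subst (x ∣_) (*-comm a b) x∣ab))
  x∣gcds : x ∣ gcd x a * gcd x b
  x∣gcds = subst (x ∣_) (sym (c*gcd[m,n]≡gcd[cm,cn] (gcd x a) x b))
    (gcd-greatest (n∣m*n (gcd x a)) (subst (x ∣_) (*-comm b (gcd x a)) x∣b*gcd))
  gcds∣x : gcd x a * gcd x b ∣ x
  gcds∣x = Coprime⇒*∣ (Coprime-∣ a⊥b (gcd[m,n]∣n x a) (gcd[m,n]∣n x b)) (gcd[m,n]∣m x a) (gcd[m,n]∣m x b)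

*-injective-coprime : ∀ {d₁ e₁ d₂ e₂} → Coprime a b → a ≢ 0 →
  d₁ ∣ a → e₁ ∣ b → d₂ ∣ a → e₂ ∣ b → d₁ * e₁ ≡ d₂ * e₂ → d₁ ≡ d₂ × e₁ ≡ e₂
*-injective-coprime {d₁ = d₁} {e₁} {d₂} {e₂} a⊥b a≢0 d₁∣a e₁∣b d₂∣a e₂∣b eq =
  d₁≡d₂ , *-cancelˡ-≡ e₁ e₂ d₁ {{≢-nonZero (∣-≢0 d₁∣a a≢0)}} (trans eq (cong (_* e₂) (sym d₁≡d₂)))
  where
  d₁≡d₂ : d₁ ≡ d₂
  d₁≡d₂ = ∣-antisym
    (coprime-divisor (Coprime-∣ a⊥b d₁∣a e₂∣b) (subst (d₁ ∣_) (trans eq (*-comm d₂ e₂)) (m∣m*n e₁)))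
    (coprime-divisor (Coprime-∣ a⊥b d₂∣a e₁∣b) (subst (d₂ ∣_) (trans (sym eq) (*-comm d₁ e₁)) (m∣m*n e₂)))

prime>1 : Prime p → 1 < p
prime>1 {p} p-prime = nonTrivial⇒n>1 p {{prime⇒nonTrivial p-prime}}

prime≢0 : Prime p → p ≢ 0
prime≢0 p-prime p≡0 = <⇒≢ (<-trans z<s (prime>1 p-prime)) (sym p≡0)

prime^≢0 : Prime p → ∀ a → p ^ a ≢ 0
prime^≢0 p-prime a = prime≢0 p-prime ∘ m^n≡0⇒m≡0 _ a

1<prime^ : Prime p → 0 < k → 1 < p ^ k
1<prime^ {p} p-prime = ^-monoʳ-< p (prime>1 p-prime)

1<prime^1+a*m : Prime p → m ≢ 0 → ∀ a → 1 < p ^ suc a * m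
1<prime^1+a*m {p} {m} p-prime m≢0 a =
  <-≤-trans (1<prime^ p-prime (z<s {a})) (m≤m*n (p ^ suc a) m {{≢-nonZero m≢0}})

prime∤⇒Coprime : Prime q → ¬ q ∣ m → Coprime q m
prime∤⇒Coprime q-prime q∤m (d∣q , d∣m) with prime⇒irreducible q-prime d∣q
... | inj₁ d≡1 = d≡1
... | inj₂ refl = ⊥-elim (q∤m d∣m)

^-∣ : ∀ p → i ≤ a → p ^ i ∣ p ^ a
^-∣ {i} {a} p i≤a = divides (p ^ (a ∸ i))
  (trans (cong (p ^_) (sym (m∸n+n≡m i≤a))) (^-distribˡ-+-* p (a ∸ i) i))

∣p^a⇒≡p^i : Prime p → ∀ a → x ∣ p ^ a → ∃ λ i → i ≤ a × x ≡ p ^ i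
∣p^a⇒≡p^i p-prime zero x∣1 = 0 , z≤n , ∣1⇒≡1 x∣1
∣p^a⇒≡p^i {p} {x} p-prime (suc a) x∣p^1+a with p ∣? x
... | no p∤x with i , i≤a , refl ← ∣p^a⇒≡p^i p-prime a
      (coprime-divisor (Coprime.sym (prime∤⇒Coprime p-prime p∤x)) x∣p^1+a) = i , m≤n⇒m≤1+n i≤a , refl
... | yes (divides y refl) with i , i≤a , refl ← ∣p^a⇒≡p^i p-prime a
      (*-cancelˡ-∣ p {{≢-nonZero (prime≢0 p-prime)}} (subst (_∣ p * p ^ a) (*-comm y p) x∣p^1+a)) =
        suc i , s≤s i≤a , *-comm (p ^ i) p

prime∣prime^⇒≡ : Prime p → Prime q → ∀ a → p ∣ q ^ a → p ≡ q
prime∣prime^⇒≡ p-prime q-prime zero    p∣1 = ⊥-elim (<⇒≢ (prime>1 p-prime) (sym (∣1⇒≡1 p∣1)))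
prime∣prime^⇒≡ {p} {q} p-prime q-prime (suc a) p∣q^1+a with euclidsLemma q (q ^ a) p-prime p∣q^1+a
... | inj₂ p∣q^a = prime∣prime^⇒≡ p-prime q-prime a p∣q^a
... | inj₁ p∣q with prime⇒irreducible q-prime p∣q
...   | inj₁ p≡1 = ⊥-elim (<⇒≢ (prime>1 p-prime) (sym p≡1))
...   | inj₂ p≡q = p≡q

p^k≡*⇒ : Prime p → p ^ k ≡ x * y → ∃₂ λ i j → x ≡ p ^ i × y ≡ p ^ j × i + j ≡ k
p^k≡*⇒ {p} {k} {x} {y} p-prime p^k≡xy
  with i , _ , refl ← ∣p^a⇒≡p^i p-prime k (divides y (trans p^k≡xy (*-comm x y)))
     | j , _ , refl ← ∣p^a⇒≡p^i p-prime k (divides x p^k≡xy) =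
  i , j , refl , refl , ^-injective (prime>1 p-prime) (trans (^-distribˡ-+-* p i j) (sym p^k≡xy))

Odd : ℕ → Set
Odd n = n % 2 ≡ 1

odd-1+2t : ∀ t → Odd (suc (t * 2))
odd-1+2t t = %-remove-+ʳ 1 {t * 2} {2} (n∣m*n t)

odd-* : Odd m → Odd n → Odd (m * n)
odd-* {m} {n} m-odd n-odd = trans (%-distribˡ-* m n 2) (cong₂ (λ x y → (x * y) % 2) m-odd n-odd)

odd-^ : Odd p → ∀ i → Odd (p ^ i)
odd-^ p-odd zero    = refl
odd-^ {p} p-odd (suc i) = odd-* {p} {p ^ i} p-odd (odd-^ p-odd i)

odd⇒∤2 : Odd n → ¬ 2 ∣ n
odd⇒∤2 {n} n-odd 2∣n = 0≢1+n (trans (sym (n∣m⇒m%n≡0 n 2 2∣n)) n-odd)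

odd-^⁻ : Odd (p ^ suc i) → Odd p
odd-^⁻ {p} {i} p^-odd with p % 2 | m%n<n p 2 | m≡m%n+[m/n]*n p 2
... | 1 | _ | _ = refl
... | 0 | _ | p≡ = ⊥-elim (odd⇒∤2 p^-odd (∣m⇒∣m*n (p ^ i) (divides (p / 2) p≡)))
... | 2+ _ | s≤s (s≤s ()) | _

odd⇒≡1+[n∸1]/2*2 : Odd n → n ≡ suc ((n ∸ 1) / 2 * 2)
odd⇒≡1+[n∸1]/2*2 {n} n-odd =
  trans n≡ (cong (λ x → suc (x * 2)) (sym (trans (cong (λ x → (x ∸ 1) / 2) n≡) (m*n/n≡m (n / 2) 2))))
  where
  n≡ : n ≡ suc (n / 2 * 2)
  n≡ = trans (m≡m%n+[m/n]*n n 2) (cong (_+ n / 2 * 2) n-odd)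

odd>1⇒[n∸1]/2≡1+f : Odd n → 1 < n → ∃ λ f → (n ∸ 1) / 2 ≡ suc f × n ≡ suc (suc f * 2)
odd>1⇒[n∸1]/2≡1+f {n} n-odd 1<n = go ((n ∸ 1) / 2) (odd⇒≡1+[n∸1]/2*2 n-odd)
  where
  go : ∀ t → n ≡ suc (t * 2) → ∃ λ f → (n ∸ 1) / 2 ≡ suc f × n ≡ suc (suc f * 2)
  go zero    n≡1 = ⊥-elim (<⇒≢ 1<n (sym n≡1))
  go (suc f) n≡  = f , trans (cong (λ x → (x ∸ 1) / 2) n≡) (m*n/n≡m (suc f) 2) , n≡

even*odd≡p^k⇒odd≡1 : ∀ {p k W D} → Prime p → p ^ k ≡ W * D → 2 ∣ W → Odd D → D ≡ 1
even*odd≡p^k⇒odd≡1 {p} {k} {W} {D} p-prime p^k≡WD 2∣W D-odd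
  with ∣p^a⇒≡p^i p-prime k (divides W p^k≡WD)
... | zero  , _ , D≡1 = D≡1
... | suc i , _ , refl = ⊥-elim (odd⇒∤2 (odd-^ (odd-^⁻ {p} {i} D-odd) k)
                          (subst (2 ∣_) (sym p^k≡WD) (∣m⇒∣m*n D 2∣W)))

factorOut : 1 < q → n ≢ 0 → ∃₂ λ a m → n ≡ q ^ a * m × ¬ q ∣ m
factorOut {q} 1<q = <-rec (λ n → n ≢ 0 → ∃₂ λ a m → n ≡ q ^ a * m × ¬ q ∣ m) step _
  where
  step : ∀ n → (∀ {k} → k < n → k ≢ 0 → ∃₂ λ a m → k ≡ q ^ a * m × ¬ q ∣ m) →
         n ≢ 0 → ∃₂ λ a m → n ≡ q ^ a * m × ¬ q ∣ m
  step n rec n≢0 with q ∣? n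
  ... | no q∤n = 0 , n , sym (+-identityʳ n) , q∤n
  ... | yes (divides k refl) = extend (rec (m<m*n k q {{≢-nonZero k≢0}} 1<q) k≢0)
    where
    k≢0 : k ≢ 0
    k≢0 k≡0 = n≢0 (cong (_* q) k≡0)
    extend : (∃₂ λ a m → k ≡ q ^ a * m × ¬ q ∣ m) → ∃₂ λ a m → k * q ≡ q ^ a * m × ¬ q ∣ m
    extend (a , m , refl , q∤m) = suc a , m , trans (*-comm _ q) (sym (*-assoc q (q ^ a) m)) , q∤m

primeFactor : 1 < n → ∃ λ q → Prime q × q ∣ n
primeFactor {n} 1<n with factorise n {{≢-nonZero (m<n⇒n≢0 1<n)}}
... | record { factors = [] ; isFactorisation = n≡1 } = ⊥-elim (<⇒≢ 1<n (sym n≡1))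
... | record { factors = q ∷ qs ; isFactorisation = refl ; factorsPrime = q-prime ∷ _ } =
  q , q-prime , m∣m*n (product qs)

PrimePowerSplit : ℕ → Set
PrimePowerSplit n = ∃ λ q → ∃₂ λ a m → Prime q × ¬ q ∣ m × m ≢ 0 × n ≡ q ^ suc a * m

splitPrimePower : 1 < n → PrimePowerSplit n
splitPrimePower {n} 1<n with q , q-prime , q∣n ← primeFactor 1<n
    with factorOut (prime>1 q-prime) (m<n⇒n≢0 1<n)
... | zero  , m , n≡m   , q∤m = ⊥-elim (q∤m (subst (q ∣_) (trans n≡m (*-identityˡ m)) q∣n))
... | suc a , m , refl , q∤m =
  q , a , m , q-prime , q∤m , (λ { refl → m<n⇒n≢0 1<n (*-zeroʳ (q ^ suc a)) }) , refl

primePower-ind : (P : ℕ → Set) → P 1 →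
  (∀ {q a m} → Prime q → ¬ q ∣ m → m ≢ 0 → P m → P (q ^ suc a * m)) →
  ∀ {n} → n ≢ 0 → P n
primePower-ind P P1 P-step {n} = <-rec (λ n → n ≢ 0 → P n) step n
  where
  step : ∀ n → (∀ {k} → k < n → k ≢ 0 → P k) → n ≢ 0 → P n
  step n rec n≢0 with n ≟ 1
  ... | yes refl = P1
  ... | no n≢1 with q , a , m , q-prime , q∤m , m≢0 , refl ← splitPrimePower (n≢0∧n≢1⇒1<n n≢0 n≢1) =
    P-step {a = a} q-prime q∤m m≢0 (rec (m<n*m m≢0 (1<prime^ q-prime (z<s {a}))) m≢0)
    where
    m<n*m : ∀ {m k} → m ≢ 0 → 1 < k → m < k * m
    m<n*m {m} {k} m≢0 1<k = subst (m <_) (*-comm m k) (m<m*n m k {{≢-nonZero m≢0}} 1<k)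

-- Divisors and unitary divisors

-- m / x with junk value 0 at x = 0; on suc x it is literally the m / suc x tested in unitaryDivisors.
cofactor : ℕ → ℕ → ℕ
cofactor m zero    = 0
cofactor m (suc x) = m / suc x

*-cofactor : x ∣ m → x * cofactor m x ≡ m
*-cofactor {zero}  (divides q m≡q*0) = sym (trans m≡q*0 (*-zeroʳ q))
*-cofactor {suc x} x∣m               = m*[n/m]≡n x∣m

cofactor-unique : x ≢ 0 → y * x ≡ m → cofactor m x ≡ y
cofactor-unique {zero}      x≢0 _    = ⊥-elim (x≢0 refl)
cofactor-unique {suc x} {y} _   refl = m*n/n≡m y (suc x)

cofactor-∣ : x ∣ m → cofactor m x ∣ m
cofactor-∣ {x} x∣m = divides x (sym (*-cofactor x∣m))

cofactor-involutive : m ≢ 0 → x ∣ m → cofactor m (cofactor m x) ≡ x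
cofactor-involutive m≢0 x∣m = cofactor-unique (∣-≢0 (cofactor-∣ x∣m) m≢0) (*-cofactor x∣m)

cofactor-* : a * b ≢ 0 → d ∣ a → e ∣ b → cofactor (a * b) (d * e) ≡ cofactor a d * cofactor b e
cofactor-* {a} {b} {d} {e} ab≢0 d∣a e∣b = cofactor-unique (∣-≢0 (*-pres-∣ d∣a e∣b) ab≢0) (begin
  cofactor a d * cofactor b e * (d * e) ≡⟨ interchange (cofactor a d) (cofactor b e) d e ⟩
  cofactor a d * d * (cofactor b e * e) ≡⟨ cong₂ _*_ (*-comm _ d) (*-comm _ e) ⟩
  d * cofactor a d * (e * cofactor b e) ≡⟨ cong₂ _*_ (*-cofactor d∣a) (*-cofactor e∣b) ⟩
  a * b                                 ∎)
  where open ≡-Reasoning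

UnitaryDivisor : ℕ → ℕ → Set
UnitaryDivisor m x = x ∣ m × Coprime x (cofactor m x)

∈-divisors⁻ : x ∈ divisors m → x ∣ m
∈-divisors⁻ {m = m} x∈ with ∈-map⁻ suc x∈
... | e , e∈ , refl = proj₂ (∈-filter⁻ (λ e → suc e ∣? m) {xs = upTo m} e∈)

∈-divisors⁺ : m ≢ 0 → x ∣ m → x ∈ divisors m
∈-divisors⁺ {m} {zero}  m≢0 0∣m = ⊥-elim (∣-≢0 0∣m m≢0 refl)
∈-divisors⁺ {m} {suc x} m≢0 x∣m =
  ∈-map⁺ suc (∈-filter⁺ (λ e → suc e ∣? m) (∈-upTo⁺ (∣⇒≤ {{≢-nonZero m≢0}} x∣m)) x∣m)

divisors-Unique : ∀ m → Unique (divisors m)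
divisors-Unique m = Unique.map⁺ suc-injective (Unique.filter⁺ _ (Unique.upTo⁺ m))

∈-unitaryDivisors⁻ : x ∈ unitaryDivisors m → UnitaryDivisor m x
∈-unitaryDivisors⁻ {m = m} x∈ with ∈-map⁻ suc x∈
... | e , e∈ , refl
  with proj₂ (∈-filter⁻ (λ e → (suc e ∣? m) ×-dec (gcd (suc e) (m / suc e) ≟ 1)) {xs = upTo m} e∈)
... | x∣m , gcd≡1 = x∣m , gcd≡1⇒coprime gcd≡1

∈-unitaryDivisors⁺ : m ≢ 0 → UnitaryDivisor m x → x ∈ unitaryDivisors m
∈-unitaryDivisors⁺ {m} {zero}  m≢0 (0∣m , _)        = ⊥-elim (∣-≢0 0∣m m≢0 refl)
∈-unitaryDivisors⁺ {m} {suc x} m≢0 (x∣m , coprime) =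
  ∈-map⁺ suc (∈-filter⁺ (λ e → (suc e ∣? m) ×-dec (gcd (suc e) (m / suc e) ≟ 1))
    (∈-upTo⁺ (∣⇒≤ {{≢-nonZero m≢0}} x∣m)) (x∣m , coprime⇒gcd≡1 coprime))

unitaryDivisors-Unique : ∀ m → Unique (unitaryDivisors m)
unitaryDivisors-Unique m = Unique.map⁺ suc-injective (Unique.filter⁺ _ (Unique.upTo⁺ m))

τ : ℕ → ℕ
τ m = length (divisors m)

τ* : ℕ → ℕ
τ* m = length (unitaryDivisors m)

T²≡^τ : m ≢ 0 → T m * T m ≡ m ^ τ m
T²≡^τ {m} m≢0 = product²-involution (cofactor m) (divisors m) (divisors-Unique m)
  (λ x∈ → ∈-divisors⁺ m≢0 (cofactor-∣ (∈-divisors⁻ x∈)))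
  (λ x∈ → cofactor-involutive m≢0 (∈-divisors⁻ x∈))
  (λ x∈ → *-cofactor (∈-divisors⁻ x∈))

T*²≡^τ* : m ≢ 0 → T* m * T* m ≡ m ^ τ* m
T*²≡^τ* {m} m≢0 = product²-involution (cofactor m) (unitaryDivisors m) (unitaryDivisors-Unique m)
  (λ x∈ → ∈-unitaryDivisors⁺ m≢0 (complement (∈-unitaryDivisors⁻ x∈)))
  (λ x∈ → cofactor-involutive m≢0 (proj₁ (∈-unitaryDivisors⁻ x∈)))
  (λ x∈ → *-cofactor (proj₁ (∈-unitaryDivisors⁻ x∈)))
  where
  complement : UnitaryDivisor m x → UnitaryDivisor m (cofactor m x)
  complement (x∣m , coprime) = cofactor-∣ x∣m ,
    subst (Coprime _) (sym (cofactor-involutive m≢0 x∣m)) (Coprime.sym coprime)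

-- Counting divisors

-- Divisors of coprime numbers multiply injectively, so no product is counted twice.
length-coprimeProducts : ∀ {xs ys zs} → Coprime a b → a ≢ 0 → Unique xs → Unique ys → Unique zs →
  (∀ {x} → x ∈ xs → x ∣ a) → (∀ {y} → y ∈ ys → y ∣ b) →
  (∀ {z} → z ∈ zs → z ∈ products xs ys) → (∀ {x y} → x ∈ xs → y ∈ ys → x * y ∈ zs) →
  length zs ≡ length xs * length ys
length-coprimeProducts {xs = xs} {ys} {zs} a⊥b a≢0 xs! ys! zs! xs∣a ys∣b ⊆ ⊇ =
  trans (↭-length (unique-sameElements⇒↭ zs! products! ⊆ ⊇′)) (length-products xs ys)
  where
  products! : Unique (products xs ys)
  products! = Unique-map⁺-injectiveOn _ injective (Unique.cartesianProduct⁺ xs! ys!)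
    where
    injective : ∀ {u v} → u ∈ cartesianProduct xs ys → v ∈ cartesianProduct xs ys →
      uncurry _*_ u ≡ uncurry _*_ v → u ≡ v
    injective {d₁ , e₁} {d₂ , e₂} u∈ v∈ eq
      with d₁∈ , e₁∈ ← ∈-cartesianProduct⁻ xs ys u∈ | d₂∈ , e₂∈ ← ∈-cartesianProduct⁻ xs ys v∈
      with refl , refl ← *-injective-coprime a⊥b a≢0 (xs∣a d₁∈) (ys∣b e₁∈) (xs∣a d₂∈) (ys∣b e₂∈) eq = refl
  ⊇′ : ∀ {z} → z ∈ products xs ys → z ∈ zs
  ⊇′ z∈ with (x , y) , xy∈ , refl ← ∈-map⁻ (uncurry _*_) z∈
        with x∈ , y∈ ← ∈-cartesianProduct⁻ xs ys xy∈ = ⊇ x∈ y∈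

τ-multiplicative : Coprime a b → a ≢ 0 → b ≢ 0 → τ (a * b) ≡ τ a * τ b
τ-multiplicative {a} {b} a⊥b a≢0 b≢0 = length-coprimeProducts a⊥b a≢0
  (divisors-Unique a) (divisors-Unique b) (divisors-Unique (a * b)) (∈-divisors⁻ {m = a}) (∈-divisors⁻ {m = b})
  split
  (λ x∈ y∈ → ∈-divisors⁺ (*-≢0 a≢0 b≢0) (*-pres-∣ (∈-divisors⁻ {m = a} x∈) (∈-divisors⁻ {m = b} y∈)))
  where
  split : x ∈ divisors (a * b) → x ∈ products (divisors a) (divisors b)
  split {x} x∈ = subst (_∈ products (divisors a) (divisors b)) (sym (∣*⇒≡gcd*gcd a⊥b (∈-divisors⁻ x∈)))
    (∈-products⁺ (∈-divisors⁺ a≢0 (gcd[m,n]∣n x a)) (∈-divisors⁺ b≢0 (gcd[m,n]∣n x b)))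

τ*-multiplicative : Coprime a b → a ≢ 0 → b ≢ 0 → τ* (a * b) ≡ τ* a * τ* b
τ*-multiplicative {a} {b} a⊥b a≢0 b≢0 = length-coprimeProducts a⊥b a≢0
  (unitaryDivisors-Unique a) (unitaryDivisors-Unique b) (unitaryDivisors-Unique (a * b))
  (proj₁ ∘ ∈-unitaryDivisors⁻ {m = a}) (proj₁ ∘ ∈-unitaryDivisors⁻ {m = b})
  (λ z∈ → split (∈-unitaryDivisors⁻ {m = a * b} z∈))
  (λ x∈ y∈ → ∈-unitaryDivisors⁺ ab≢0
    (combine (∈-unitaryDivisors⁻ {m = a} x∈) (∈-unitaryDivisors⁻ {m = b} y∈)))
  where
  ab≢0 = *-≢0 a≢0 b≢0
  split : UnitaryDivisor (a * b) x → x ∈ products (unitaryDivisors a) (unitaryDivisors b)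
  split {x} (x∣ab , x⊥x′) = subst (_∈ products (unitaryDivisors a) (unitaryDivisors b)) (sym x≡)
    (∈-products⁺ (∈-unitaryDivisors⁺ a≢0 (gcd[m,n]∣n x a , Coprime-∣ x⊥x′ (gcd[m,n]∣m x a) xa′∣x′))
                 (∈-unitaryDivisors⁺ b≢0 (gcd[m,n]∣n x b , Coprime-∣ x⊥x′ (gcd[m,n]∣m x b) xb′∣x′)))
    where
    xa = gcd x a
    xb = gcd x b
    x≡ : x ≡ xa * xb
    x≡ = ∣*⇒≡gcd*gcd a⊥b x∣ab
    x′≡ : cofactor (a * b) x ≡ cofactor a xa * cofactor b xb
    x′≡ = trans (cong (cofactor (a * b)) x≡) (cofactor-* ab≢0 (gcd[m,n]∣n x a) (gcd[m,n]∣n x b))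
    xa′∣x′ : cofactor a xa ∣ cofactor (a * b) x
    xa′∣x′ = subst (cofactor a xa ∣_) (sym x′≡) (m∣m*n (cofactor b xb))
    xb′∣x′ : cofactor b xb ∣ cofactor (a * b) x
    xb′∣x′ = subst (cofactor b xb ∣_) (sym x′≡) (n∣m*n (cofactor a xa))
  combine : UnitaryDivisor a x → UnitaryDivisor b y → UnitaryDivisor (a * b) (x * y)
  combine {x} {y} (x∣a , x⊥x′) (y∣b , y⊥y′) = *-pres-∣ x∣a y∣b ,
    subst (Coprime (x * y)) (sym (cofactor-* ab≢0 x∣a y∣b))
      (Coprime-*ˡ (Coprime-*ʳ x⊥x′ (Coprime-∣ a⊥b x∣a (cofactor-∣ y∣b)))
                  (Coprime-*ʳ (Coprime-∣ (Coprime.sym a⊥b) y∣b (cofactor-∣ x∣a)) y⊥y′))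

τ[p^a] : Prime p → ∀ a → τ (p ^ a) ≡ suc a
τ[p^a] {p} p-prime a = begin
  τ (p ^ a)                       ≡⟨ ↭-length (unique-sameElements⇒↭ (divisors-Unique (p ^ a)) powers! ⊆ ⊇) ⟩
  length (map (p ^_) (upTo (suc a))) ≡⟨ length-map (p ^_) (upTo (suc a)) ⟩
  length (upTo (suc a))            ≡⟨ length-upTo (suc a) ⟩
  suc a                            ∎
  where
  open ≡-Reasoning
  powers! : Unique (map (p ^_) (upTo (suc a)))
  powers! = Unique.map⁺ (^-injective (prime>1 p-prime)) (Unique.upTo⁺ (suc a))
  ⊆ : x ∈ divisors (p ^ a) → x ∈ map (p ^_) (upTo (suc a))
  ⊆ x∈ with i , i≤a , refl ← ∣p^a⇒≡p^i p-prime a (∈-divisors⁻ {m = p ^ a} x∈) =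
    ∈-map⁺ (p ^_) (∈-upTo⁺ (s≤s i≤a))
  ⊇ : x ∈ map (p ^_) (upTo (suc a)) → x ∈ divisors (p ^ a)
  ⊇ x∈ with i , i∈ , refl ← ∈-map⁻ (p ^_) x∈ =
    ∈-divisors⁺ (prime^≢0 p-prime a) (^-∣ p (≤-pred (∈-upTo⁻ i∈)))

-- A proper divisor p^i (0 < i < a) of p^a leaves the cofactor p^(a-i), which shares the factor p.
τ*[p^1+a] : Prime p → ∀ a → τ* (p ^ suc a) ≡ 2
τ*[p^1+a] {p} p-prime a = ↭-length (unique-sameElements⇒↭ (unitaryDivisors-Unique P) 1∷P! ⊆ ⊇)
  where
  P = p ^ suc a
  1<P : 1 < P
  1<P = 1<prime^ p-prime (z<s {a})
  1∷P! : Unique (1 ∷ P ∷ [])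
  1∷P! = ((<⇒≢ 1<P) All.∷ All.[]) ∷ (All.[] ∷ [])
  ⊆ : x ∈ unitaryDivisors P → x ∈ 1 ∷ P ∷ []
  ⊆ x∈ with x∣P , x⊥x′ ← ∈-unitaryDivisors⁻ {m = P} x∈ with ∣p^a⇒≡p^i p-prime (suc a) x∣P
  ... | zero  , _   , refl = here refl
  ... | suc i , i≤a , refl with suc i ≟ suc a
  ...   | yes refl = there (here refl)
  ...   | no i≢a   = ⊥-elim (<⇒≢ (prime>1 p-prime) (sym (x⊥x′ (m∣m*n (p ^ i) , p∣x′))))
    where
    x′≡ : cofactor P (p ^ suc i) ≡ p ^ (suc a ∸ suc i)
    x′≡ = cofactor-unique (prime^≢0 p-prime (suc i))
      (trans (sym (^-distribˡ-+-* p (suc a ∸ suc i) (suc i))) (cong (p ^_) (m∸n+n≡m i≤a)))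
    p∣x′ : p ∣ cofactor P (p ^ suc i)
    p∣x′ with suc a ∸ suc i | m<n⇒0<n∸m (≤∧≢⇒< i≤a i≢a) | x′≡
    ... | suc j | _ | eq = subst (p ∣_) (sym eq) (m∣m*n (p ^ j))
  ⊇ : x ∈ 1 ∷ P ∷ [] → x ∈ unitaryDivisors P
  ⊇ (here refl)         = ∈-unitaryDivisors⁺ (prime^≢0 p-prime (suc a))
    (divides P (sym (*-identityʳ P)) , λ (d∣1 , _) → ∣1⇒≡1 d∣1)
  ⊇ (there (here refl)) = ∈-unitaryDivisors⁺ (prime^≢0 p-prime (suc a))
    (∣-refl , subst (Coprime P) (sym (cofactor-unique (prime^≢0 p-prime (suc a)) (*-identityˡ P)))
      λ (_ , d∣1) → ∣1⇒≡1 d∣1)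

τ*-splitPrimePower : Prime q → ¬ q ∣ m → m ≢ 0 → ∀ a → τ* (q ^ suc a * m) ≡ 2 * τ* m
τ*-splitPrimePower {q} {m} q-prime q∤m m≢0 a = begin
  τ* (q ^ suc a * m)       ≡⟨ τ*-multiplicative (Coprime-^ˡ (prime∤⇒Coprime q-prime q∤m) (suc a))
                               (prime^≢0 q-prime (suc a)) m≢0 ⟩
  τ* (q ^ suc a) * τ* m    ≡⟨ cong (_* τ* m) (τ*[p^1+a] q-prime a) ⟩
  2 * τ* m                 ∎
  where open ≡-Reasoning

τ-splitPrimePower : Prime q → ¬ q ∣ m → m ≢ 0 → ∀ a j → τ ((q ^ suc a * m) ^ j) ≡ suc (suc a * j) * τ (m ^ j)
τ-splitPrimePower {q} {m} q-prime q∤m m≢0 a j = begin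
  τ ((q ^ suc a * m) ^ j)          ≡⟨ cong τ (^-distribʳ-* (q ^ suc a) m j) ⟩
  τ ((q ^ suc a) ^ j * m ^ j)      ≡⟨ cong (λ x → τ (x * m ^ j)) (^-*-assoc q (suc a) j) ⟩
  τ (q ^ (suc a * j) * m ^ j)      ≡⟨ τ-multiplicative q^⊥m^ (prime^≢0 q-prime (suc a * j)) (m≢0 ∘ m^n≡0⇒m≡0 m j) ⟩
  τ (q ^ (suc a * j)) * τ (m ^ j)  ≡⟨ cong (_* τ (m ^ j)) (τ[p^a] q-prime (suc a * j)) ⟩
  suc (suc a * j) * τ (m ^ j)      ∎
  where
  open ≡-Reasoning
  q^⊥m^ : Coprime (q ^ (suc a * j)) (m ^ j)
  q^⊥m^ = Coprime.sym (Coprime-^ˡ (Coprime.sym (Coprime-^ˡ (prime∤⇒Coprime q-prime q∤m) (suc a * j))) j)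

τ[n^h]-odd : 2 ∣ h → n ≢ 0 → Odd (τ (n ^ h))
τ[n^h]-odd {h = h} 2∣h = primePower-ind (λ n → Odd (τ (n ^ h)))
  (subst (Odd ∘ τ) (sym (^-zeroˡ h)) refl)
  λ {_} {a} q-prime q∤m m≢0 τ[m^h]-odd → subst Odd (sym (τ-splitPrimePower q-prime q∤m m≢0 a h))
    (odd-* {suc (suc a * h)} {τ (_ ^ h)} (%-remove-+ʳ 1 (∣n⇒∣m*n (suc a) 2∣h)) τ[m^h]-odd)

1<n⇒2∣τ* : 1 < n → 2 ∣ τ* n
1<n⇒2∣τ* 1<n with q , a , m , q-prime , q∤m , m≢0 , refl ← splitPrimePower 1<n =
  divides (τ* m) (trans (τ*-splitPrimePower q-prime q∤m m≢0 a) (*-comm 2 (τ* m)))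

-- The perfection criterion

T*≡^ : n ≢ 0 → τ* n ≡ 2 * h → T* n ≡ n ^ h
T*≡^ {n} {h} n≢0 τ*≡2h = m*m≡n*n⇒m≡n (begin
  T* n * T* n     ≡⟨ T*²≡^τ* n≢0 ⟩
  n ^ τ* n        ≡⟨ cong (n ^_) τ*≡2h ⟩
  n ^ (2 * h)     ≡⟨ ^-double n h ⟩
  n ^ h * n ^ h   ∎)
  where open ≡-Reasoning

T[T*]²≡^ : n ≢ 0 → τ* n ≡ 2 * h → T (T* n) * T (T* n) ≡ n ^ (h * τ (n ^ h))
T[T*]²≡^ {n} {h} n≢0 τ*≡2h = begin
  T (T* n) * T (T* n)       ≡⟨ cong (λ x → T x * T x) (T*≡^ {h = h} n≢0 τ*≡2h) ⟩
  T (n ^ h) * T (n ^ h)     ≡⟨ T²≡^τ (n≢0 ∘ m^n≡0⇒m≡0 n h) ⟩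
  (n ^ h) ^ τ (n ^ h)       ≡⟨ ^-*-assoc n h (τ (n ^ h)) ⟩
  n ^ (h * τ (n ^ h))       ∎
  where open ≡-Reasoning

TT*≡^⇔ : 1 < n → τ* n ≡ 2 * h → h * τ (n ^ h) ≡ D → (T (T* n) ≡ n ^ K ⇔ 2 * K ≡ D)
TT*≡^⇔ {n} {h} {D} {K} 1<n τ*≡2h hτ≡D = mk⇔
  (λ TT*≡ → ^-injective 1<n (begin
    n ^ (2 * K)             ≡⟨ ^-double n K ⟩
    n ^ K * n ^ K           ≡⟨ cong (λ x → x * x) TT*≡ ⟨
    T (T* n) * T (T* n)     ≡⟨ TT*² ⟩
    n ^ D                   ∎))
  (λ 2K≡D → m*m≡n*n⇒m≡n (begin
    T (T* n) * T (T* n)     ≡⟨ TT*² ⟩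
    n ^ D                   ≡⟨ cong (n ^_) 2K≡D ⟨
    n ^ (2 * K)             ≡⟨ ^-double n K ⟩
    n ^ K * n ^ K           ∎))
  where
  open ≡-Reasoning
  TT*² : T (T* n) * T (T* n) ≡ n ^ D
  TT*² = trans (T[T*]²≡^ {h = h} (m<n⇒n≢0 1<n) τ*≡2h) (cong (n ^_) hτ≡D)

TT*-primePower⇔ : Prime q → ∀ e → (T (T* (q ^ suc e)) ≡ (q ^ suc e) ^ K ⇔ 2 * K ≡ 2 + e)
TT*-primePower⇔ {q} {K} q-prime e = TT*≡^⇔ {h = 1} {K = K} (1<prime^ q-prime (z<s {e})) (τ*[p^1+a] q-prime e)
  (trans (*-identityˡ _) (trans (cong τ (^-identityʳ (q ^ suc e))) (τ[p^a] q-prime (suc e))))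

2*-cancel⇔ : 2 * x ≡ 2 * y ⇔ x ≡ y
2*-cancel⇔ {x} {y} = mk⇔ (*-cancelˡ-≡ x y 2) (cong (2 *_))

TT*-twoPrimePowers⇔ : ∀ {q₁ q₂} → Prime q₁ → Prime q₂ → q₁ ≢ q₂ → ∀ e₁ e₂ →
  let n = q₁ ^ suc e₁ * q₂ ^ suc e₂ in
  (T (T* n) ≡ n ^ K ⇔ K ≡ suc (suc e₁ * 2) * suc (suc e₂ * 2))
TT*-twoPrimePowers⇔ {K} {q₁} {q₂} q₁-prime q₂-prime q₁≢q₂ e₁ e₂ =
  ⇔-trans (TT*≡^⇔ {h = 2} {K = K} (1<prime^1+a*m q₁-prime Q₂≢0 e₁) τ*≡4 2τ≡) 2*-cancel⇔
  where
  Q₂ = q₂ ^ suc e₂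
  q₁∤Q₂ : ¬ q₁ ∣ Q₂
  q₁∤Q₂ = q₁≢q₂ ∘ prime∣prime^⇒≡ q₁-prime q₂-prime (suc e₂)
  Q₂≢0 = prime^≢0 q₂-prime (suc e₂)
  τ*≡4 : τ* (q₁ ^ suc e₁ * Q₂) ≡ 2 * 2
  τ*≡4 = trans (τ*-splitPrimePower q₁-prime q₁∤Q₂ Q₂≢0 e₁) (cong (2 *_) (τ*[p^1+a] q₂-prime e₂))
  2τ≡ : 2 * τ ((q₁ ^ suc e₁ * Q₂) ^ 2) ≡ 2 * (suc (suc e₁ * 2) * suc (suc e₂ * 2))
  2τ≡ = cong (2 *_) (trans (τ-splitPrimePower q₁-prime q₁∤Q₂ Q₂≢0 e₁ 2) (cong (suc (suc e₁ * 2) *_)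
    (trans (cong τ (^-*-assoc q₂ (suc e₂) 2)) (τ[p^a] q₂-prime (suc e₂ * 2)))))

-- τ*(m) = 2W with W even means m has at least two prime factors.
¬TT*≡^prime^ : Prime p → Prime q → ¬ q ∣ m → m ≢ 0 → τ* m ≡ 2 * W → 2 ∣ W →
  ¬ T (T* (q ^ suc a * m)) ≡ (q ^ suc a * m) ^ (p ^ k)
¬TT*≡^prime^ {p} {q} {m} {W} {a} {k} p-prime q-prime q∤m m≢0 τ*≡2W 2∣W TT*≡ = prime^≢0 p-prime k p^k≡0
  where
  N = q ^ suc a * m
  Δ = τ (N ^ τ* m)
  p^k≡WΔ : p ^ k ≡ W * Δ
  p^k≡WΔ = *-cancelˡ-≡ (p ^ k) (W * Δ) 2 (begin
    2 * p ^ k     ≡⟨ Equivalence.to (TT*≡^⇔ {h = τ* m} {D = τ* m * Δ} {K = p ^ k}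
                       (1<prime^1+a*m q-prime m≢0 a) (τ*-splitPrimePower q-prime q∤m m≢0 a) refl) TT*≡ ⟩
    τ* m * Δ      ≡⟨ cong (_* Δ) τ*≡2W ⟩
    2 * W * Δ     ≡⟨ *-assoc 2 W Δ ⟩
    2 * (W * Δ)   ∎)
    where open ≡-Reasoning
  Δ≡1 : Δ ≡ 1
  Δ≡1 = even*odd≡p^k⇒odd≡1 {p} {k} {W} {Δ} p-prime p^k≡WΔ 2∣W
    (τ[n^h]-odd (divides W (trans τ*≡2W (*-comm 2 W))) (*-≢0 (prime^≢0 q-prime (suc a)) m≢0))
  τ*m≡0 : τ* m ≡ 0
  τ*m≡0 = [ (λ ()) , (λ τ*m≡0 → τ*m≡0) ]′ (m*n≡0⇒m≡0∨n≡0 (suc a) (suc-injective (m*n≡1⇒m≡1 _ (τ (m ^ τ* m))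
    (trans (sym (τ-splitPrimePower q-prime q∤m m≢0 a (τ* m))) Δ≡1))))
  p^k≡0 : p ^ k ≡ 0
  p^k≡0 = trans p^k≡WΔ (cong (_* Δ) (*-cancelˡ-≡ W 0 2 (trans (sym τ*≡2W) τ*m≡0)))

-- Classification

PrimePowerForm : ℕ → ℕ → Set
PrimePowerForm K n = ∃[ p₁ ] (Prime p₁ × n ≡ p₁ ^ (2 * K ∸ 1))

TwoPrimePowerForm : ℕ → ℕ → ℕ → Set
TwoPrimePowerForm p k n = p % 2 ≡ 1 × ∃[ p₁ ] ∃[ p₂ ] ∃[ a₁ ] ∃[ a₂ ]
  (Prime p₁ × Prime p₂ × p₁ ≢ p₂ × 1 ≤ a₁ × 1 ≤ a₂ × a₁ + a₂ ≡ k
   × n ≡ p₁ ^ ((p ^ a₁ ∸ 1) / 2) * p₂ ^ ((p ^ a₂ ∸ 1) / 2))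

-- For K = 2 + j, 2K - 1 reduces to 1 + (j + (K + 0)).
primePowerForm⇒perfect : ∀ {K} → 2 ≤ K → PrimePowerForm K n → KPerfect K n
primePowerForm⇒perfect {n} {K@(suc (suc j))} 2≤K (q , q-prime , refl) =
  2≤K , 1<prime^ {k = suc (j + (K + 0))} q-prime z<s ,
  Equivalence.from (TT*-primePower⇔ {K = K} q-prime (j + (K + 0))) refl
primePowerForm⇒perfect {K = 1} (s≤s ()) _

twoPrimePowerForm⇒perfect : Prime p → TwoPrimePowerForm p k n → KPerfect (p ^ k) n
twoPrimePowerForm⇒perfect {p} p-prime
  (p-odd , q₁ , q₂ , a₁ , a₂ , q₁-prime , q₂-prime , q₁≢q₂ , 1≤a₁ , 1≤a₂ , refl , refl)
  with f₁ , e₁≡ , p^a₁≡ ← odd>1⇒[n∸1]/2≡1+f (odd-^ p-odd a₁) (1<prime^ p-prime 1≤a₁)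
     | f₂ , e₂≡ , p^a₂≡ ← odd>1⇒[n∸1]/2≡1+f (odd-^ p-odd a₂) (1<prime^ p-prime 1≤a₂)
  rewrite e₁≡ | e₂≡ | ^-distribˡ-+-* p a₁ a₂ | p^a₁≡ | p^a₂≡ =
  s≤s (s≤s z≤n) ,
  1<prime^1+a*m q₁-prime (prime^≢0 q₂-prime (suc f₂)) f₁ ,
  Equivalence.from (TT*-twoPrimePowers⇔ q₁-prime q₂-prime q₁≢q₂ f₁ f₂) refl

perfect-primePower⇒form : Prime q → T (T* (q ^ suc a * 1)) ≡ (q ^ suc a * 1) ^ K → PrimePowerForm K (q ^ suc a * 1)
perfect-primePower⇒form {q} {a} {K} q-prime TT*≡ =
  q , q-prime , trans (*-identityʳ (q ^ suc a)) (cong (λ e → q ^ (e ∸ 1)) (sym 2K≡2+a))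
  where
  2K≡2+a : 2 * K ≡ 2 + a
  2K≡2+a = Equivalence.to (TT*-primePower⇔ {K = K} q-prime a)
    (subst (λ m → T (T* m) ≡ m ^ K) (*-identityʳ (q ^ suc a)) TT*≡)

perfect-twoPrimePowers⇒form : Prime p → Prime q → Prime q′ → q ≢ q′ →
  T (T* (q ^ suc a * (q′ ^ suc b * 1))) ≡ (q ^ suc a * (q′ ^ suc b * 1)) ^ (p ^ k) →
  TwoPrimePowerForm p k (q ^ suc a * (q′ ^ suc b * 1))
perfect-twoPrimePowers⇒form {p} {q} {q′} {a} {b} {k} p-prime q-prime q′-prime q≢q′ TT*≡ = form (p^k≡*⇒ p-prime p^k≡XY)
  where
  X = suc (suc a * 2)
  Y = suc (suc b * 2)
  p^k≡XY : p ^ k ≡ X * Y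
  p^k≡XY = Equivalence.to (TT*-twoPrimePowers⇔ {K = p ^ k} q-prime q′-prime q≢q′ a b)
    (subst (λ m → T (T* (q ^ suc a * m)) ≡ (q ^ suc a * m) ^ (p ^ k)) (*-identityʳ (q′ ^ suc b)) TT*≡)
  halfExponent : ∀ {e x} → suc (suc e * 2) ≡ x → (x ∸ 1) / 2 ≡ suc e
  halfExponent {e} refl = m*n/n≡m (suc e) 2
  form : (∃₂ λ i j → X ≡ p ^ i × Y ≡ p ^ j × i + j ≡ k) → TwoPrimePowerForm p k (q ^ suc a * (q′ ^ suc b * 1))
  form (zero  , _     , ()  , _   , _)
  form (_     , zero  , _   , ()  , _)
  form (suc i , suc j , X≡ , Y≡ , i+j≡k) =
    odd-^⁻ {p} {i} (subst Odd X≡ (odd-1+2t (suc a))) ,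
    q , q′ , suc i , suc j , q-prime , q′-prime , q≢q′ , s≤s z≤n , s≤s z≤n , i+j≡k ,
    trans (cong (q ^ suc a *_) (*-identityʳ (q′ ^ suc b)))
      (cong₂ (λ x y → q ^ x * q′ ^ y) (sym (halfExponent {a} X≡)) (sym (halfExponent {b} Y≡)))

-- Cases by the number of distinct prime factors of n: one, two, or at least three.
perfect⇒form : Prime p → 1 < n → T (T* n) ≡ n ^ (p ^ k) → PrimePowerForm (p ^ k) n ⊎ TwoPrimePowerForm p k n
perfect⇒form {p} {k = k} p-prime 1<n TT*≡
  with q , a , m , q-prime , q∤m , m≢0 , refl ← splitPrimePower 1<n with m ≟ 1
... | yes refl = inj₁ (perfect-primePower⇒form {q} {a} {p ^ k} q-prime TT*≡)
... | no m≢1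
  with q′ , b , m′ , q′-prime , q′∤m′ , m′≢0 , refl ← splitPrimePower (n≢0∧n≢1⇒1<n m≢0 m≢1) with m′ ≟ 1
...   | yes refl = inj₂ (perfect-twoPrimePowers⇒form {p} {q} {q′} {a} {b} {k} p-prime q-prime q′-prime q≢q′ TT*≡)
  where
  q≢q′ : q ≢ q′
  q≢q′ refl = q∤m (∣m⇒∣m*n 1 (m∣m*n (q ^ b)))
...   | no m′≢1 = ⊥-elim (¬TT*≡^prime^ {p} {q} {m} {τ* m′} {a} {k} p-prime q-prime q∤m m≢0
                           (τ*-splitPrimePower q′-prime q′∤m′ m′≢0 b) (1<n⇒2∣τ* (n≢0∧n≢1⇒1<n m′≢0 m′≢1)) TT*≡)

theorem3p3 : (k : ℕ) → 1 ≤ k →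
    ((p p₁ : ℕ) → Prime p → Prime p₁ → KPerfect (p ^ k) (p₁ ^ (2 * p ^ k ∸ 1)))
    × (2 ≤ k → (p : ℕ) → Prime p → p % 2 ≡ 1 →
        (p₁ p₂ a₁ a₂ : ℕ) → Prime p₁ → Prime p₂ → p₁ ≢ p₂ →
        1 ≤ a₁ → 1 ≤ a₂ → a₁ + a₂ ≡ k →
        KPerfect (p ^ k) (p₁ ^ ((p ^ a₁ ∸ 1) / 2) * p₂ ^ ((p ^ a₂ ∸ 1) / 2)))
    × ((p n : ℕ) → Prime p → 1 < n →
        ¬ (∃[ p₁ ] (Prime p₁ × n ≡ p₁ ^ (2 * p ^ k ∸ 1))) →
        ¬ (p % 2 ≡ 1 × ∃[ p₁ ] ∃[ p₂ ] ∃[ a₁ ] ∃[ a₂ ]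
             (Prime p₁ × Prime p₂ × p₁ ≢ p₂ × 1 ≤ a₁ × 1 ≤ a₂ × a₁ + a₂ ≡ k
              × n ≡ p₁ ^ ((p ^ a₁ ∸ 1) / 2) * p₂ ^ ((p ^ a₂ ∸ 1) / 2))) →
        ¬ KPerfect (p ^ k) n)
theorem3p3 k 1≤k =
  (λ p q p-prime q-prime → primePowerForm⇒perfect (1<prime^ {k = k} p-prime 1≤k) (q , q-prime , refl)) ,
  (λ _ p p-prime p-odd q₁ q₂ a₁ a₂ q₁-prime q₂-prime q₁≢q₂ 1≤a₁ 1≤a₂ a₁+a₂≡k →
    twoPrimePowerForm⇒perfect p-prime
      (p-odd , q₁ , q₂ , a₁ , a₂ , q₁-prime , q₂-prime , q₁≢q₂ , 1≤a₁ , 1≤a₂ , a₁+a₂≡k , refl)) ,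
  λ p n p-prime 1<n ¬primePowerForm ¬twoPrimePowerForm (_ , _ , TT*≡) →
    [ ¬primePowerForm , ¬twoPrimePowerForm ]′ (perfect⇒form {k = k} p-prime 1<n TT*≡)
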